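{- Let $m,n$ be integers with $0<m<n$, and let $\tfrac{h_j}{k_j}<\tfrac{h_{j+1}}{k_{j+1}}<\tfrac{h_{j+2}}{k_{j+2}}$ be three successive fractions (in lowest terms) of $\mathcal F(\mathbb B(n),m;\rho)$. (i) With $M:=\bigl\lfloor\min\{\tfrac{h_{j+2}+m}{h_{j+1}},\tfrac{k_{j+2}+n}{k_{j+1}},\tfrac{k_{j+2}-h_{j+2}+n-m}{k_{j+1}-h_{j+1}}\}\bigr\rfloor$, one has $h_j=Mh_{j+1}-h_{j+2}$ and $k_j=Mk_{j+1}-k_{j+2}$. (ii) With $M':=\bigl\lfloor\min\{\tfrac{h_j+m}{h_{j+1}},\tfrac{k_j+n}{k_{j+1}},\tfrac{k_j-h_j+n-m}{k_{j+1}-h_{j+1}}\}\bigr\rfloor$, one has $h_{j+2}=M'h_{j+1}-h_j$ and $k_{j+2}=M'k_{j+1}-k_j$.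
   Context: $\mathcal F_n$ is the Farey sequence of order $n$: the ascending sequence of all irreducible fractions in $[0,1]$ with denominator at most $n$. For $0\le m\le n$, $\mathcal F(\mathbb B(n),m;\rho)$ is the ascending sequence of irreducible fractions $\{\tfrac01,\tfrac11\}\cup\{\tfrac hk\in\mathcal F_n:\ h\le m,\ k-h\le n-m\}$ (equivalently, $\tfrac01,\tfrac11$ together with the reduced forms of $\rho(a\wedge b)/\rho(b)$ for $b\neq\hat0$ in the Boolean lattice $\mathbb B(n)$ of rank $n$, where $a$ is a fixed element of rank $m$ and $\rho$ is rank). -}

module Defs where

open import Data.Nat using (ℕ; zero; suc; _+_; _*_; _∸_; _≤_; _<_)
open import Data.Nat.Coprimality using (Coprime)
open import Data.Integer using (ℤ; +_)
open import Data.Rational using (ℚ; _/_; _⊓_; floor)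
open import Data.Product using (_×_; _,_)
open import Data.Sum using (_⊎_)
open import Relation.Binary.PropositionalEquality using (_≡_)
open import Relation.Nullary using (¬_)

InFarey : (n h k : ℕ) → Set
InFarey n h k = Coprime h k × 1 ≤ k × h ≤ k × k ≤ n

InFB : (n m h k : ℕ) → Set
InFB n m h k =
  (h ≡ 0 × k ≡ 1) ⊎ (h ≡ 1 × k ≡ 1) ⊎ (InFarey n h k × h ≤ m × k ∸ h ≤ n ∸ m)

FracLt : (h k h' k' : ℕ) → Set
FracLt h k h' k' = h * k' < h' * k

Consecutive : (n m h k h' k' : ℕ) → Set
Consecutive n m h k h' k' =
  InFB n m h k × InFB n m h' k' × FracLt h k h' k' ×
  (∀ x y → InFB n m x y → ¬ (FracLt h k x y × FracLt x y h' k'))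

-- the rational number a/b (for b = 0 this is a junk value 0; it is only
-- ever applied with b > 0 in the statement, which is forced by the hypotheses)
frac : ℕ → ℕ → ℚ
frac a zero = + 0 / 1
frac a (suc b) = + a / suc b

floorMin3 : (a₁ b₁ a₂ b₂ a₃ b₃ : ℕ) → ℤ
floorMin3 a₁ b₁ a₂ b₂ a₃ b₃ = floor ((frac a₁ b₁ ⊓ frac a₂ b₂) ⊓ frac a₃ b₃)

{-# OPTIONS --safe #-}

-- For 0 < m < n, a fraction h/k belongs to F(B(n), m; ρ) iff it is reduced with
-- h ≤ m and k − h ≤ n − m.  Consecutive members h₀/k₀ < h₁/k₁ satisfy
-- h₁k₀ − h₀k₁ = 1: were this determinant D ≥ 2, Bézout would give a lattice point
-- (P, Q) = ((h₀, k₀) + j·(h₁, k₁)) / D with 0 < j < D and h₁Q − Pk₁ = 1, a reduced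
-- fraction strictly between the two which, as a convex combination of them, obeys
-- the same bounds.  Hence for three consecutive members (h₀ + h₂, k₀ + k₂) is
-- proportional to the primitive vector (h₁, k₁), say M times it.  Since h₀ ≤ m,
-- k₀ ≤ n and k₀ − h₀ ≤ n − m, the integer M lies below each of the three ratios,
-- and M + 1 cannot: otherwise the mediant (h₀ + h₁)/(k₀ + k₁) would be a member
-- between h₀/k₀ and h₁/k₁.  So M is the floor of the minimum, and symmetrically
-- with h₂/k₂ and the mediant (h₁ + h₂)/(k₁ + k₂).
module Submission where

open import Defs
open import Data.Nat
  using (ℕ; zero; suc; _+_; _*_; _∸_; _≤_; _<_; z≤n; s≤s; z<s; NonZero; >-nonZero; >-nonZero⁻¹)
open import Data.Integer using (+_) renaming (_*_ to _*ℤ_; _-_ to _-ℤ_)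
open import Data.Product using (_×_; _,_; proj₁; proj₂; ∃₂; ∃-syntax)
open import Relation.Binary.PropositionalEquality
  using (_≡_; refl; sym; trans; cong; cong₂; subst; subst₂; module ≡-Reasoning)

import Algebra.Properties.CommutativeSemigroup as CommSemigroup
open import Data.Empty using (⊥-elim)
open import Data.Integer.Base as ℤ using (ℤ; -[1+_]; 1ℤ)
import Data.Integer.DivMod as ℤ
import Data.Integer.Properties as ℤ
open import Data.Integer.Tactic.RingSolver using (solve-∀)
open import Data.Nat.Coprimality as Coprimality
  using (Coprime; coprime-Bézout; coprime-divisor; 1-coprimeTo)
open import Data.Nat.Divisibility using (_∣_; divides; ∣1⇒≡1; ∣m+n∣m⇒∣n; ∣m⇒∣m*n; ∣n⇒∣m*n)
open import Data.Nat.GCD using (module Bézout)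
open import Data.Nat.Properties
open import Data.Rational.Base as ℚ using (floor; _⊓_; ↥_; ↧_; ↧ₙ_)
open import Data.Rational.Literals using (fromℤ)
import Data.Rational.Properties as ℚ
open import Data.Rational.Unnormalised.Base as ℚᵘ using (mkℚᵘ)
import Data.Rational.Unnormalised.Properties as ℚᵘ
open import Data.Sum using (inj₁; inj₂)
open import Function.Base using (case_of_)
open import Relation.Nullary using (¬_; yes; no; contradiction)

open CommSemigroup *-commutativeSemigroup using (x∙yz≈z∙yx)

pos-*-mono-≤ : ∀ {a b c d} → a * b ≤ c * d → + a ℤ.* + b ℤ.≤ + c ℤ.* + d
pos-*-mono-≤ {a} {b} {c} {d} le = subst₂ ℤ._≤_ (ℤ.pos-* a b) (ℤ.pos-* c d) (ℤ.+≤+ le)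

pos-*-mono-< : ∀ {a b c d} → a * b < c * d → + a ℤ.* + b ℤ.< + c ℤ.* + d
pos-*-mono-< {a} {b} {c} {d} lt = subst₂ ℤ._<_ (ℤ.pos-* a b) (ℤ.pos-* c d) (ℤ.+<+ lt)

floor-unique : ∀ p z → fromℤ z ℚ.≤ p → p ℚ.< fromℤ (ℤ.suc z) → floor p ≡ z
floor-unique p@(ℚ.mkℚ _ _ _) z (ℚ.*≤* z≤p) (ℚ.*<* p<1+z) = ℤ.≤-antisym
  (squeeze {floor p} {z} (ℤ.[n/d]*d≤n (↥ p) (↧ p))
           (subst (ℤ._< ℤ.suc z ℤ.* ↧ p) (ℤ.*-identityʳ (↥ p)) p<1+z))
  (squeeze {z} {floor p} (subst (z ℤ.* ↧ p ℤ.≤_) (ℤ.*-identityʳ (↥ p)) z≤p)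
           (subst (λ q → ↥ p ℤ.< ℤ.suc q ℤ.* ↧ p) (sym (ℤ.div-pos-is-/ℕ (↥ p) (↧ₙ p)))
                  (ℤ.n<s[n/ℕd]*d (↥ p) (↧ₙ p))))
  where
  squeeze : ∀ {a b} → a ℤ.* ↧ p ℤ.≤ ↥ p → ↥ p ℤ.< ℤ.suc b ℤ.* ↧ p → a ℤ.≤ b
  squeeze {a} {b} lower upper = subst (a ℤ.≤_) (ℤ.pred-suc b)
    (ℤ.i<j⇒i≤pred[j] (ℤ.*-cancelʳ-<-nonNeg {a} {ℤ.suc b} (↧ p) (ℤ.≤-<-trans lower upper)))

fromℕ≤frac : ∀ {M a b} → 0 < b → M * b ≤ a → fromℤ (+ M) ℚ.≤ frac a b
fromℕ≤frac {M} {a} {suc b} _ Mb≤a = ℚ.toℚᵘ-cancel-≤ {fromℤ (+ M)} {frac a (suc b)}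
  (ℚᵘ.≤-respʳ-≃ {mkℚᵘ (+ M) 0} (ℚᵘ.≃-sym (ℚ.toℚᵘ-fromℚᵘ (mkℚᵘ (+ a) b)))
    (ℚᵘ.*≤* (pos-*-mono-≤ {M} {suc b} {a} {1} (subst (M * suc b ≤_) (sym (*-identityʳ a)) Mb≤a))))

frac<fromℕ : ∀ {M a b} → 0 < b → a < M * b → frac a b ℚ.< fromℤ (+ M)
frac<fromℕ {M} {a} {suc b} _ a<Mb = ℚ.toℚᵘ-cancel-< {frac a (suc b)} {fromℤ (+ M)}
  (ℚᵘ.<-respˡ-≃ {mkℚᵘ (+ M) 0} (ℚᵘ.≃-sym (ℚ.toℚᵘ-fromℚᵘ (mkℚᵘ (+ a) b)))
    (ℚᵘ.*<* (pos-*-mono-< {a} {1} {M} {suc b} (subst (_< M * suc b) (sym (*-identityʳ a)) a<Mb))))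

floorMin3-≡ : ∀ {M a₁ b₁ a₂ b₂ a₃ b₃} → 0 < b₁ → 0 < b₂ → 0 < b₃ →
  M * b₁ ≤ a₁ → M * b₂ ≤ a₂ → M * b₃ ≤ a₃ →
  ¬ (suc M * b₁ ≤ a₁ × suc M * b₂ ≤ a₂ × suc M * b₃ ≤ a₃) →
  floorMin3 a₁ b₁ a₂ b₂ a₃ b₃ ≡ + M
floorMin3-≡ {M} {a₁} {b₁} {a₂} {b₂} {a₃} {b₃} 0<b₁ 0<b₂ 0<b₃ l₁ l₂ l₃ ¬u =
  floor-unique ((q₁ ⊓ q₂) ⊓ q₃) (+ M)
    (ℚ.⊓-glb (ℚ.⊓-glb (fromℕ≤frac 0<b₁ l₁) (fromℕ≤frac 0<b₂ l₂)) (fromℕ≤frac 0<b₃ l₃))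
    upper
  where
  q₁ = frac a₁ b₁
  q₂ = frac a₂ b₂
  q₃ = frac a₃ b₃
  upper : (q₁ ⊓ q₂) ⊓ q₃ ℚ.< fromℤ (+ suc M)
  upper with suc M * b₁ ≤? a₁ | suc M * b₂ ≤? a₂ | suc M * b₃ ≤? a₃
  ... | no u₁ | _ | _ = ℚ.≤-<-trans (ℚ.≤-trans (ℚ.p⊓q≤p (q₁ ⊓ q₂) q₃) (ℚ.p⊓q≤p q₁ q₂))
                                    (frac<fromℕ 0<b₁ (≰⇒> u₁))
  ... | _ | no u₂ | _ = ℚ.≤-<-trans (ℚ.≤-trans (ℚ.p⊓q≤p (q₁ ⊓ q₂) q₃) (ℚ.p⊓q≤q q₁ q₂))
                                    (frac<fromℕ 0<b₂ (≰⇒> u₂))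
  ... | _ | _ | no u₃ = ℚ.≤-<-trans (ℚ.p⊓q≤q (q₁ ⊓ q₂) q₃) (frac<fromℕ 0<b₃ (≰⇒> u₃))
  ... | yes u₁ | yes u₂ | yes u₃ = ⊥-elim (¬u (u₁ , u₂ , u₃))

[m+n]∸[o+p]≡[m∸o]+[n∸p] : ∀ {m n o p} → o ≤ m → p ≤ n → (m + n) ∸ (o + p) ≡ (m ∸ o) + (n ∸ p)
[m+n]∸[o+p]≡[m∸o]+[n∸p] {m} {n} {o} {p} o≤m p≤n = begin
  (m + n) ∸ (o + p)  ≡⟨ ∸-+-assoc (m + n) o p ⟨
  (m + n) ∸ o ∸ p    ≡⟨ cong (_∸ p) (+-∸-comm n o≤m) ⟩
  (m ∸ o) + n ∸ p    ≡⟨ +-∸-assoc (m ∸ o) p≤n ⟩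
  (m ∸ o) + (n ∸ p)  ∎
  where open ≡-Reasoning

0<m*n⇒0<n : ∀ m {n} → 0 < m * n → 0 < n
0<m*n⇒0<n m {n} 0<mn = >-nonZero⁻¹ n {{m*n≢0⇒n≢0 m {{>-nonZero 0<mn}}}}

convex-combination-≤ : ∀ {D P x y j B} → D * P ≡ x + j * y → j < D → x ≤ B → y ≤ B → P ≤ B
convex-combination-≤ {D@(suc _)} {P} {x} {y} {j} {B} e j<D x≤B y≤B = *-cancelˡ-≤ D (begin
  D * P      ≡⟨ e ⟩
  x + j * y  ≤⟨ +-mono-≤ x≤B (*-monoʳ-≤ j y≤B) ⟩
  suc j * B  ≤⟨ *-monoˡ-≤ B j<D ⟩
  D * B      ∎)
  where open ≤-Reasoning

det≡1⇒coprime : ∀ {h k h′ k′} → h′ * k ≡ 1 + h * k′ → Coprime h k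
det≡1⇒coprime {h} {h′ = h′} {k′ = k′} e {i} (i∣h , i∣k) =
  ∣1⇒≡1 (∣m+n∣m⇒∣n (subst (i ∣_) (trans e (+-comm 1 (h * k′))) (∣n⇒∣m*n h′ i∣k)) (∣m⇒∣m*n k′ i∣h))

coprime-proportional : ∀ {h k a b} → Coprime h k → 0 < h → k * a ≡ h * b →
  ∃[ M ] a ≡ M * h × b ≡ M * k
coprime-proportional {h} {k} {a} {b} c 0<h e
  with coprime-divisor c (divides b (trans e (*-comm h b)))
... | divides M a≡Mh = M , a≡Mh , *-cancelˡ-≡ b (M * k) h {{>-nonZero 0<h}} (begin
  h * b        ≡⟨ e ⟨
  k * a        ≡⟨ cong (k *_) a≡Mh ⟩
  k * (M * h)  ≡⟨ x∙yz≈z∙yx k M h ⟩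
  h * (M * k)  ∎)
  where open ≡-Reasoning

[i+j]-j≡i : ∀ i j → (i ℤ.+ j) ℤ.- j ≡ i
[i+j]-j≡i = solve-∀

i≡[i-j]+j : ∀ i j → i ≡ (i ℤ.- j) ℤ.+ j
i≡[i-j]+j = solve-∀

toℤ-sum : ∀ {m n o} → m ≡ n + o → + m ℤ.- + o ≡ + n
toℤ-sum {n = n} {o} refl = trans (cong (ℤ._- + o) (ℤ.pos-+ n o)) ([i+j]-j≡i (+ n) (+ o))

toℤ-cross : ∀ a b c d {n} → a * b ≡ n + c * d → + a ℤ.* + b ℤ.- + c ℤ.* + d ≡ + n
toℤ-cross a b c d e = trans (sym (cong₂ ℤ._-_ (ℤ.pos-* a b) (ℤ.pos-* c d))) (toℤ-sum e)

fromℤ-cross : ∀ a b c d {n} → + a ℤ.* + b ℤ.- + c ℤ.* + d ≡ + n → a * b ≡ n + c * d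
fromℤ-cross a b c d {n} e = ℤ.+-injective (begin
  + (a * b)                                   ≡⟨ ℤ.pos-* a b ⟩
  + a ℤ.* + b                                 ≡⟨ i≡[i-j]+j (+ a ℤ.* + b) (+ c ℤ.* + d) ⟩
  (+ a ℤ.* + b ℤ.- + c ℤ.* + d) ℤ.+ + c ℤ.* + d ≡⟨ cong₂ ℤ._+_ e (sym (ℤ.pos-* c d)) ⟩
  + n ℤ.+ + (c * d)                           ≡⟨ ℤ.pos-+ n (c * d) ⟨
  + (n + c * d)                               ∎)
  where open ≡-Reasoning

bézout : ∀ {h k} → Coprime h k → ∃₂ λ p q → + h ℤ.* q ℤ.- p ℤ.* + k ≡ 1ℤ
bézout {h} {k} c with coprime-Bézout c
... | Bézout.+- x y eq = + y , + x , toℤ-cross h x y k (trans (*-comm h x) (sym eq))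
... | Bézout.-+ x y eq = ℤ.- + y , ℤ.- + x , trans (negate (+ h) (+ k) (+ x) (+ y)) (toℤ-cross y k x h (sym eq))
  where
  negate : ∀ (i j u v : ℤ) → i ℤ.* ℤ.- u ℤ.- ℤ.- v ℤ.* j ≡ v ℤ.* j ℤ.- u ℤ.* i
  negate = solve-∀

-- Moving (p, q) by t·(h₁, k₁) keeps h₁q − pk₁ and lowers pk₀ − h₀q by t·D.
shift-into-range : ∀ {h₀ k₀ h₁ k₁ p q : ℤ} D .{{_ : NonZero D}} →
  h₁ ℤ.* k₀ ℤ.- h₀ ℤ.* k₁ ≡ + D → h₁ ℤ.* q ℤ.- p ℤ.* k₁ ≡ 1ℤ →
  ∃[ j ] ∃₂ λ P Q → j < D × h₁ ℤ.* Q ℤ.- P ℤ.* k₁ ≡ 1ℤ × P ℤ.* k₀ ℤ.- h₀ ℤ.* Q ≡ + j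
shift-into-range {h₀} {k₀} {h₁} {k₁} {p} {q} D detD det₁ =
  j , p ℤ.- t ℤ.* h₁ , q ℤ.- t ℤ.* k₁ , ℤ.n%ℕd<d j₀ D ,
  trans (keep h₁ k₁ p q t) det₁ ,
  (begin
    (p ℤ.- t ℤ.* h₁) ℤ.* k₀ ℤ.- h₀ ℤ.* (q ℤ.- t ℤ.* k₁) ≡⟨ lower h₀ k₀ h₁ k₁ p q t ⟩
    j₀ ℤ.- t ℤ.* (h₁ ℤ.* k₀ ℤ.- h₀ ℤ.* k₁)              ≡⟨ cong (λ d → j₀ ℤ.- t ℤ.* d) detD ⟩
    j₀ ℤ.- t ℤ.* + D                                    ≡⟨ cong (ℤ._- t ℤ.* + D) (ℤ.a≡a%ℕn+[a/ℕn]*n j₀ D) ⟩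
    (+ j ℤ.+ t ℤ.* + D) ℤ.- t ℤ.* + D                   ≡⟨ [i+j]-j≡i (+ j) (t ℤ.* + D) ⟩
    + j                                                 ∎)
  where
  open ≡-Reasoning
  j₀ = p ℤ.* k₀ ℤ.- h₀ ℤ.* q
  t = j₀ ℤ./ℕ D
  j = j₀ ℤ.%ℕ D
  keep : ∀ h₁ k₁ p q t → h₁ ℤ.* (q ℤ.- t ℤ.* k₁) ℤ.- (p ℤ.- t ℤ.* h₁) ℤ.* k₁ ≡ h₁ ℤ.* q ℤ.- p ℤ.* k₁
  keep = solve-∀
  lower : ∀ h₀ k₀ h₁ k₁ p q t →
    (p ℤ.- t ℤ.* h₁) ℤ.* k₀ ℤ.- h₀ ℤ.* (q ℤ.- t ℤ.* k₁) ≡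
    (p ℤ.* k₀ ℤ.- h₀ ℤ.* q) ℤ.- t ℤ.* (h₁ ℤ.* k₀ ℤ.- h₀ ℤ.* k₁)
  lower = solve-∀

cramerʰ : ∀ h₀ k₀ h₁ k₁ P Q →
  (h₁ ℤ.* k₀ ℤ.- h₀ ℤ.* k₁) ℤ.* P ≡ h₀ ℤ.* (h₁ ℤ.* Q ℤ.- P ℤ.* k₁) ℤ.+ h₁ ℤ.* (P ℤ.* k₀ ℤ.- h₀ ℤ.* Q)
cramerʰ = solve-∀

cramerᵏ : ∀ h₀ k₀ h₁ k₁ P Q →
  (h₁ ℤ.* k₀ ℤ.- h₀ ℤ.* k₁) ℤ.* Q ≡ k₀ ℤ.* (h₁ ℤ.* Q ℤ.- P ℤ.* k₁) ℤ.+ k₁ ℤ.* (P ℤ.* k₀ ℤ.- h₀ ℤ.* Q)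
cramerᵏ = solve-∀

cramer-pos : ∀ {h₀ k₀ h₁ k₁ D j} P Q → + h₁ ℤ.* + k₀ ℤ.- + h₀ ℤ.* + k₁ ≡ + D →
  + h₁ ℤ.* Q ℤ.- P ℤ.* + k₁ ≡ 1ℤ → P ℤ.* + k₀ ℤ.- + h₀ ℤ.* Q ≡ + j →
  + D ℤ.* P ≡ + (h₀ + j * h₁) × + D ℤ.* Q ≡ + (k₀ + j * k₁)
cramer-pos {h₀} {k₀} {h₁} {k₁} {D} {j} P Q detD det₁ detⱼ =
  affine h₀ h₁ (cramerʰ (+ h₀) (+ k₀) (+ h₁) (+ k₁) P Q) ,
  affine k₀ k₁ (cramerᵏ (+ h₀) (+ k₀) (+ h₁) (+ k₁) P Q)
  where
  open ≡-Reasoning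
  affine : ∀ a b {X} →
    (+ h₁ ℤ.* + k₀ ℤ.- + h₀ ℤ.* + k₁) ℤ.* X ≡
      + a ℤ.* (+ h₁ ℤ.* Q ℤ.- P ℤ.* + k₁) ℤ.+ + b ℤ.* (P ℤ.* + k₀ ℤ.- + h₀ ℤ.* Q) →
    + D ℤ.* X ≡ + (a + j * b)
  affine a b {X} e = begin
    + D ℤ.* X                       ≡⟨ cong (ℤ._* X) detD ⟨
    (+ h₁ ℤ.* + k₀ ℤ.- + h₀ ℤ.* + k₁) ℤ.* X ≡⟨ e ⟩
    + a ℤ.* (+ h₁ ℤ.* Q ℤ.- P ℤ.* + k₁) ℤ.+ + b ℤ.* (P ℤ.* + k₀ ℤ.- + h₀ ℤ.* Q)
                                    ≡⟨ cong₂ (λ u v → + a ℤ.* u ℤ.+ + b ℤ.* v) det₁ detⱼ ⟩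
    + a ℤ.* 1ℤ ℤ.+ + b ℤ.* + j      ≡⟨ cong₂ ℤ._+_ (ℤ.*-identityʳ (+ a)) (sym (ℤ.pos-* b j)) ⟩
    + a ℤ.+ + (b * j)               ≡⟨ cong (λ c → + a ℤ.+ + c) (*-comm b j) ⟩
    + a ℤ.+ + (j * b)               ≡⟨ ℤ.pos-+ a (j * b) ⟨
    + (a + j * b)                   ∎

natural-point : ∀ {h₀ k₀ h₁ k₁ D j} P Q → 0 < D →
  + h₁ ℤ.* Q ℤ.- P ℤ.* + k₁ ≡ 1ℤ → P ℤ.* + k₀ ℤ.- + h₀ ℤ.* Q ≡ + j →
  + D ℤ.* P ≡ + (h₀ + j * h₁) → + D ℤ.* Q ≡ + (k₀ + j * k₁) →
  ∃₂ λ P′ Q′ → h₁ * Q′ ≡ 1 + P′ * k₁ × P′ * k₀ ≡ j + h₀ * Q′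
             × D * P′ ≡ h₀ + j * h₁ × D * Q′ ≡ k₀ + j * k₁
natural-point {h₀} {k₀} {h₁} {k₁} {D} (+ P′) (+ Q′) _ det₁ detⱼ DP DQ =
  P′ , Q′ , fromℤ-cross h₁ Q′ P′ k₁ det₁ , fromℤ-cross P′ k₀ h₀ Q′ detⱼ ,
  ℤ.+-injective (trans (ℤ.pos-* D P′) DP) , ℤ.+-injective (trans (ℤ.pos-* D Q′) DQ)
natural-point {D = suc _} -[1+ _ ] _ _ _ _ () _
natural-point {D = suc _} (+ _) -[1+ _ ] _ _ _ _ ()

-- (P, Q) = ((h₀, k₀) + j·(h₁, k₁)) / D is the point of the half-open parallelogram
-- spanned by (h₀, k₀) and (h₁, k₁) on the line h₁Q − Pk₁ = 1.
lattice-point : ∀ {h₀ k₀ h₁ k₁} D .{{_ : NonZero D}} → h₁ * k₀ ≡ D + h₀ * k₁ → Coprime h₁ k₁ →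
  ∃[ j ] ∃₂ λ P Q → j < D × h₁ * Q ≡ 1 + P * k₁ × P * k₀ ≡ j + h₀ * Q
                  × D * P ≡ h₀ + j * h₁ × D * Q ≡ k₀ + j * k₁
lattice-point {h₀} {k₀} {h₁} {k₁} D eqD cop =
  case bézout cop of λ where
    (p , q , det₁) → case shift-into-range {+ h₀} {+ k₀} {+ h₁} {+ k₁} {p} {q} D detD det₁ of λ where
      (j , P , Q , j<D , detP , detⱼ) →
        let DP , DQ = cramer-pos {h₀} {k₀} {h₁} {k₁} {D} {j} P Q detD detP detⱼ in
        case natural-point {h₀} {k₀} {h₁} {k₁} {D} {j} P Q (>-nonZero⁻¹ D) detP detⱼ DP DQ of λ where
          (P′ , Q′ , equations) → j , P′ , Q′ , j<D , equations
  where
  detD = toℤ-cross h₁ k₀ h₀ k₁ eqD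

Bounded : (n m h k : ℕ) → Set
Bounded n m h k = h ≤ m × k ≤ n × k ∸ h ≤ n ∸ m

record InBox (n m h k : ℕ) : Set where
  constructor box
  field
    coprime : Coprime h k
    0<k     : 0 < k
    h≤k     : h ≤ k
    bounded : Bounded n m h k

InFB⇒InBox : ∀ {n m h k} → 0 < m → m < n → InFB n m h k → InBox n m h k
InFB⇒InBox 0<m m<n (inj₁ (refl , refl)) =
  box (Coprimality.sym (1-coprimeTo 0)) z<s z≤n (z≤n , <-trans 0<m m<n , m<n⇒0<n∸m m<n)
InFB⇒InBox 0<m m<n (inj₂ (inj₁ (refl , refl))) =
  box (1-coprimeTo 1) z<s ≤-refl (0<m , <-trans 0<m m<n , z≤n)
InFB⇒InBox _ _ (inj₂ (inj₂ ((c , 0<k , h≤k , k≤n) , h≤m , k∸h≤n∸m))) =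
  box c 0<k h≤k (h≤m , k≤n , k∸h≤n∸m)

InBox⇒InFB : ∀ {n m h k} → InBox n m h k → InFB n m h k
InBox⇒InFB (box c 0<k h≤k (h≤m , k≤n , k∸h≤n∸m)) = inj₂ (inj₂ ((c , 0<k , h≤k , k≤n) , h≤m , k∸h≤n∸m))


lattice-point-in-box : ∀ {n m h₀ k₀ h₁ k₁ D j P Q} → InBox n m h₀ k₀ → InBox n m h₁ k₁ → j < D →
  h₁ * Q ≡ 1 + P * k₁ → D * P ≡ h₀ + j * h₁ → D * Q ≡ k₀ + j * k₁ → InBox n m P Q
lattice-point-in-box {h₀ = h₀} {k₀} {h₁} {k₁} {D} {j} {P} {Q}
  (box _ _ h₀≤k₀ (h₀≤m , k₀≤n , d₀≤n∸m)) (box _ _ h₁≤k₁ (h₁≤m , k₁≤n , d₁≤n∸m)) j<D detP DP DQ =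
  box (det≡1⇒coprime {h′ = h₁} {k′ = k₁} detP) (0<m*n⇒0<n h₁ (subst (0 <_) (sym detP) z<s)) P≤Q
      (convex-combination-≤ DP j<D h₀≤m h₁≤m ,
       convex-combination-≤ DQ j<D k₀≤n k₁≤n ,
       convex-combination-≤ D[Q∸P] j<D d₀≤n∸m d₁≤n∸m)
  where
  jh₁≤jk₁ : j * h₁ ≤ j * k₁
  jh₁≤jk₁ = *-monoʳ-≤ j h₁≤k₁
  P≤Q : P ≤ Q
  P≤Q = *-cancelˡ-≤ D {{>-nonZero (≤-<-trans z≤n j<D)}} (begin
    D * P        ≡⟨ DP ⟩
    h₀ + j * h₁  ≤⟨ +-mono-≤ h₀≤k₀ jh₁≤jk₁ ⟩
    k₀ + j * k₁  ≡⟨ DQ ⟨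
    D * Q        ∎)
    where open ≤-Reasoning
  D[Q∸P] : D * (Q ∸ P) ≡ (k₀ ∸ h₀) + j * (k₁ ∸ h₁)
  D[Q∸P] = begin
    D * (Q ∸ P)                      ≡⟨ *-distribˡ-∸ D Q P ⟩
    D * Q ∸ D * P                    ≡⟨ cong₂ _∸_ DQ DP ⟩
    (k₀ + j * k₁) ∸ (h₀ + j * h₁)    ≡⟨ [m+n]∸[o+p]≡[m∸o]+[n∸p] h₀≤k₀ jh₁≤jk₁ ⟩
    (k₀ ∸ h₀) + (j * k₁ ∸ j * h₁)    ≡⟨ cong (_+_ (k₀ ∸ h₀)) (*-distribˡ-∸ j k₁ h₁) ⟨
    (k₀ ∸ h₀) + j * (k₁ ∸ h₁)        ∎
    where open ≡-Reasoning

FracLt⇒0<num : ∀ {h k h′ k′} → FracLt h k h′ k′ → 0 < h′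
FracLt⇒0<num {h} {h′ = zero} {k′} lt = contradiction lt (n≮0 {h * k′})
FracLt⇒0<num {h′ = suc _} _ = z<s

FracLt⇒num<den : ∀ {h k h′ k′} → h′ ≤ k′ → FracLt h k h′ k′ → h < k
FracLt⇒num<den {h} {k} {h′} {k′} h′≤k′ lt = *-cancelʳ-< k′ h k (begin-strict
  h * k′   <⟨ lt ⟩
  h′ * k   ≤⟨ *-monoˡ-≤ k h′≤k′ ⟩
  k′ * k   ≡⟨ *-comm k′ k ⟩
  k * k′   ∎)
  where open ≤-Reasoning

box-point-between : ∀ {n m h₀ k₀ h₁ k₁ D} → InBox n m h₀ k₀ → InBox n m h₁ k₁ →
  h₁ * k₀ ≡ D + h₀ * k₁ → 2 ≤ D →
  ∃₂ λ P Q → InBox n m P Q × FracLt h₀ k₀ P Q × FracLt P Q h₁ k₁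
box-point-between {h₀ = h₀} {k₁ = k₁} {D = D} b₀ b₁ eqD (s≤s (s≤s z≤n)) =
  case lattice-point D eqD (InBox.coprime b₁) of λ where
    (zero , P , Q , _ , _ , _ , DP , DQ) →
      -- j = 0 would make D a common divisor of h₀ and k₀
      contradiction (InBox.coprime b₀ (divides P (factor P DP) , divides Q (factor Q DQ))) λ ()
    (suc j , P , Q , j<D , detP , detⱼ , DP , DQ) →
      P , Q , lattice-point-in-box b₀ b₁ j<D detP DP DQ ,
      subst (h₀ * Q <_) (sym detⱼ) (m<n+m (h₀ * Q) z<s) ,
      subst (P * k₁ <_) (sym detP) ≤-refl
  where
  factor : ∀ X {a} → D * X ≡ a + 0 → a ≡ X * D
  factor X {a} e = trans (sym (+-identityʳ a)) (trans (sym e) (*-comm D X))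

consecutive⇒det≡1 : ∀ {n m h₀ k₀ h₁ k₁} → 0 < m → m < n →
  Consecutive n m h₀ k₀ h₁ k₁ → h₁ * k₀ ≡ 1 + h₀ * k₁
consecutive⇒det≡1 {h₀ = h₀} {k₀} {h₁} {k₁} 0<m m<n (i₀ , i₁ , lt , gap)
  with h₁ * k₀ ∸ h₀ * k₁ | sym (m∸n+n≡m (<⇒≤ lt))
... | zero | eqD = contradiction (sym eqD) (<⇒≢ lt)
... | suc zero | eqD = eqD
... | suc (suc _) | eqD =
  let P , Q , inBox , between =
        box-point-between (InFB⇒InBox 0<m m<n i₀) (InFB⇒InBox 0<m m<n i₁) eqD (s≤s (s≤s z≤n))
  in contradiction between (gap P Q (InBox⇒InFB inBox))

mediant-between : ∀ {h k h′ k′} → FracLt h k h′ k′ →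
  FracLt h k (h + h′) (k + k′) × FracLt (h + h′) (k + k′) h′ k′
mediant-between {h} {k} {h′} {k′} lt =
  subst₂ _<_ (sym (*-distribˡ-+ h k k′)) (sym (*-distribʳ-+ k h h′)) (+-monoʳ-< (h * k) lt) ,
  subst₂ _<_ (sym (*-distribʳ-+ k′ h h′)) (sym (*-distribˡ-+ h′ k k′)) (+-monoˡ-< (h′ * k′) lt)

mediant-unbounded : ∀ {n m h k h′ k′} → 0 < m → m < n →
  Consecutive n m h k h′ k′ → ¬ Bounded n m (h + h′) (k + k′)
mediant-unbounded {h = h} {k} {h′} {k′} 0<m m<n c@(i , i′ , lt , gap) bounded =
  gap (h + h′) (k + k′)
    (InBox⇒InFB (box (det≡1⇒coprime {h′ = h′} {k′ = k′} det) (<-≤-trans 0<k (m≤m+n k k′))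
                     (+-mono-≤ h≤k h′≤k′) bounded))
    (mediant-between {h} {k} {h′} {k′} lt)
  where
  open InBox (InFB⇒InBox 0<m m<n i) using (0<k; h≤k)
  open InBox (InFB⇒InBox 0<m m<n i′) using () renaming (h≤k to h′≤k′)
  det : h′ * (k + k′) ≡ 1 + (h + h′) * k′
  det = begin
    h′ * (k + k′)           ≡⟨ *-distribˡ-+ h′ k k′ ⟩
    h′ * k + h′ * k′        ≡⟨ cong (_+ h′ * k′) (consecutive⇒det≡1 0<m m<n c) ⟩
    1 + (h * k′ + h′ * k′)  ≡⟨ cong suc (*-distribʳ-+ k′ h h′) ⟨
    1 + (h + h′) * k′       ∎
    where open ≡-Reasoning

consecutive-sum : ∀ {n m h₀ k₀ h₁ k₁ h₂ k₂} → 0 < m → m < n →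
  Consecutive n m h₀ k₀ h₁ k₁ → Consecutive n m h₁ k₁ h₂ k₂ →
  ∃[ M ] h₀ + h₂ ≡ M * h₁ × k₀ + k₂ ≡ M * k₁
consecutive-sum {h₀ = h₀} {k₀} {h₁} {k₁} {h₂} {k₂} 0<m m<n c₀₁ c₁₂ =
  coprime-proportional {a = h₀ + h₂} {b = k₀ + k₂} (InBox.coprime (InFB⇒InBox 0<m m<n (proj₁ c₁₂)))
    (FracLt⇒0<num {h₀} {k₀} {h₁} {k₁} (proj₁ (proj₂ (proj₂ c₀₁)))) (begin
    k₁ * (h₀ + h₂)             ≡⟨ *-distribˡ-+ k₁ h₀ h₂ ⟩
    k₁ * h₀ + k₁ * h₂          ≡⟨ cong₂ _+_ (*-comm k₁ h₀) (*-comm k₁ h₂) ⟩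
    h₀ * k₁ + h₂ * k₁          ≡⟨ cong (_+_ (h₀ * k₁)) (consecutive⇒det≡1 0<m m<n c₁₂) ⟩
    h₀ * k₁ + (1 + h₁ * k₂)    ≡⟨ +-suc (h₀ * k₁) (h₁ * k₂) ⟩
    1 + h₀ * k₁ + h₁ * k₂      ≡⟨ cong (_+ h₁ * k₂) (consecutive⇒det≡1 0<m m<n c₀₁) ⟨
    h₁ * k₀ + h₁ * k₂          ≡⟨ *-distribˡ-+ h₁ k₀ k₂ ⟨
    h₁ * (k₀ + k₂)             ∎)
  where open ≡-Reasoning

recurrence : ∀ {n m h₁ k₁ h k h′ k′ M} → 0 < h₁ → h₁ < k₁ → InBox n m h k → h′ ≤ k′ →
  h + h′ ≡ M * h₁ → k + k′ ≡ M * k₁ → ¬ Bounded n m (h + h₁) (k + k₁) →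
  let M′ = floorMin3 (h′ + m) h₁ (k′ + n) k₁ (k′ ∸ h′ + (n ∸ m)) (k₁ ∸ h₁) in
  (+ h ≡ M′ *ℤ + h₁ -ℤ + h′) × (+ k ≡ M′ *ℤ + k₁ -ℤ + k′)
recurrence {n} {m} {h₁} {k₁} {h} {k} {h′} {k′} {M} 0<h₁ h₁<k₁
  (box _ _ h≤k (h≤m , k≤n , k∸h≤n∸m)) h′≤k′ eh ek unbounded =
  subst (λ z → + h ≡ z *ℤ + h₁ -ℤ + h′) (sym floor≡M) (recover eh) ,
  subst (λ z → + k ≡ z *ℤ + k₁ -ℤ + k′) (sym floor≡M) (recover ek)
  where
  h₁≤k₁ = <⇒≤ h₁<k₁
  ed : (k ∸ h) + (k′ ∸ h′) ≡ M * (k₁ ∸ h₁)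
  ed = begin
    (k ∸ h) + (k′ ∸ h′)  ≡⟨ [m+n]∸[o+p]≡[m∸o]+[n∸p] h≤k h′≤k′ ⟨
    (k + k′) ∸ (h + h′)  ≡⟨ cong₂ _∸_ ek eh ⟩
    M * k₁ ∸ M * h₁      ≡⟨ *-distribˡ-∸ M k₁ h₁ ⟨
    M * (k₁ ∸ h₁)        ∎
    where open ≡-Reasoning
  below : ∀ {t f x B} → t ≤ B → t + f ≡ M * x → M * x ≤ f + B
  below {t} {f} {x} {B} t≤B e = subst₂ _≤_ e (+-comm B f) (+-monoˡ-≤ f t≤B)
  above : ∀ {t f x B} → t + f ≡ M * x → suc M * x ≤ f + B → t + x ≤ B
  above {t} {f} {x} {B} e le = +-cancelʳ-≤ f (t + x) B (begin
    t + x + f    ≡⟨ cong (_+ f) (+-comm t x) ⟩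
    x + t + f    ≡⟨ +-assoc x t f ⟩
    x + (t + f)  ≡⟨ cong (_+_ x) e ⟩
    suc M * x    ≤⟨ le ⟩
    f + B        ≡⟨ +-comm f B ⟩
    B + f        ∎)
    where open ≤-Reasoning
  floor≡M : floorMin3 (h′ + m) h₁ (k′ + n) k₁ (k′ ∸ h′ + (n ∸ m)) (k₁ ∸ h₁) ≡ + M
  floor≡M = floorMin3-≡ 0<h₁ (<-trans 0<h₁ h₁<k₁) (m<n⇒0<n∸m h₁<k₁)
    (below h≤m eh) (below k≤n ek) (below k∸h≤n∸m ed)
    λ (u₁ , u₂ , u₃) → unbounded (above eh u₁ , above ek u₂ ,
      subst (_≤ n ∸ m) (sym ([m+n]∸[o+p]≡[m∸o]+[n∸p] h≤k h₁≤k₁)) (above ed u₃))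
  recover : ∀ {t f x} → t + f ≡ M * x → + t ≡ + M *ℤ + x -ℤ + f
  recover {t} {f} {x} e = sym (trans (cong (_-ℤ + f) (sym (ℤ.pos-* M x))) (toℤ-sum (sym e)))

proposition7p8 : (m n : ℕ) → 0 < m → m < n →
    (h₀ k₀ h₁ k₁ h₂ k₂ : ℕ) →
    Consecutive n m h₀ k₀ h₁ k₁ → Consecutive n m h₁ k₁ h₂ k₂ →
    ((+ h₀ ≡ floorMin3 (h₂ + m) h₁ (k₂ + n) k₁ (k₂ ∸ h₂ + (n ∸ m)) (k₁ ∸ h₁) *ℤ + h₁ -ℤ + h₂)
      × (+ k₀ ≡ floorMin3 (h₂ + m) h₁ (k₂ + n) k₁ (k₂ ∸ h₂ + (n ∸ m)) (k₁ ∸ h₁) *ℤ + k₁ -ℤ + k₂))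
    × ((+ h₂ ≡ floorMin3 (h₀ + m) h₁ (k₀ + n) k₁ (k₀ ∸ h₀ + (n ∸ m)) (k₁ ∸ h₁) *ℤ + h₁ -ℤ + h₀)
      × (+ k₂ ≡ floorMin3 (h₀ + m) h₁ (k₀ + n) k₁ (k₀ ∸ h₀ + (n ∸ m)) (k₁ ∸ h₁) *ℤ + k₁ -ℤ + k₀))
proposition7p8 m n 0<m m<n h₀ k₀ h₁ k₁ h₂ k₂ c₀₁@(i₀ , _ , h₀/k₀<h₁/k₁ , _) c₁₂@(_ , i₂ , h₁/k₁<h₂/k₂ , _)
  with consecutive-sum 0<m m<n c₀₁ c₁₂
... | M , h₀+h₂≡Mh₁ , k₀+k₂≡Mk₁ =
  recurrence {M = M} 0<h₁ h₁<k₁ box₀ (InBox.h≤k box₂) h₀+h₂≡Mh₁ k₀+k₂≡Mk₁ (mediant-unbounded 0<m m<n c₀₁) ,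
  recurrence {M = M} 0<h₁ h₁<k₁ box₂ (InBox.h≤k box₀)
    (trans (+-comm h₂ h₀) h₀+h₂≡Mh₁) (trans (+-comm k₂ k₀) k₀+k₂≡Mk₁)
    (subst₂ (λ h k → ¬ Bounded n m h k) (+-comm h₁ h₂) (+-comm k₁ k₂) (mediant-unbounded 0<m m<n c₁₂))
  where
  box₀ = InFB⇒InBox 0<m m<n i₀
  box₂ = InFB⇒InBox 0<m m<n i₂
  0<h₁ = FracLt⇒0<num {h₀} {k₀} {h₁} {k₁} h₀/k₀<h₁/k₁
  h₁<k₁ = FracLt⇒num<den {h₁} {k₁} {h₂} {k₂} (InBox.h≤k box₂) h₁/k₁<h₂/k₂
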